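{- Let $\mathcal{R}s=(\mathcal{L}\xleftarrow{\mathbf{L}}\mathcal{P}\xrightarrow{\mathbf{R}}\mathcal{R},S)$ and $\mathcal{R}s'=(\mathcal{L}'\xleftarrow{\mathbf{L}'}\mathcal{P}'\xrightarrow{\mathbf{R}'}\mathcal{R}',S')$ be two categorical rewriting systems with $\mathcal{R}=\mathcal{L}'$. If $\mathcal{R}s$ and $\mathcal{R}s'$ are functorial, then their composition $\mathcal{R}s'\circ\mathcal{R}s$ is functorial.
   Context: A categorical rewriting system consists of a span of categories $\mathcal{L}\xleftarrow{\mathbf{L}}\mathcal{P}\xrightarrow{\mathbf{R}}\mathcal{R}$ (functors $\mathbf{L},\mathbf{R}$) together with, for each object $\rho$ of $\mathcal{P}$, a partial function $S_\rho$ from the set of morphisms of $\mathcal{L}$ with source $\mathbf{L}(\rho)$ to the set of morphisms of $\mathcal{P}$ with source $\rho$, such that $\mathbf{L}(S_\rho(f))=f$ for every $f\in\mathrm{dom}(S_\rho)$. A rule $\rho$ (object of $\mathcal{P}$) with $\mathbf{L}(\rho)=L$, $\mathbf{R}(\rho)=R$ is written $\rho:L\rightsquigarrow R$. Such a system is functorial if for every rule $\rho:L\rightsquigarrow R$: (i) $\mathrm{id}_L\in\mathrm{dom}(S_\rho)$ and $S_\rho(\mathrm{id}_L)=\mathrm{id}_\rho$; (ii) for all morphisms $f_1:L\to L_1$, $f_2:L_1\to L_2$ of $\mathcal{L}$, if $f_1\in\mathrm{dom}(S_\rho)$ and $f_2\in\mathrm{dom}(S_{\rho_1})$ where $\rho_1$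 is the target of $S_\rho(f_1)$, then $f_2\circ f_1\in\mathrm{dom}(S_\rho)$ and $S_{\rho_1}(f_2)\circ S_\rho(f_1)=S_\rho(f_2\circ f_1)$ (equalities up to isomorphism). Composition: let $\mathcal{P}''$ be the pullback of $\mathbf{R}$ and $\mathbf{L}'$: its objects are pairs $(\rho,\rho')$ with $\rho\in|\mathcal{P}|$, $\rho'\in|\mathcal{P}'|$, $\mathbf{R}(\rho)=\mathbf{L}'(\rho')$, and its morphisms $(\rho,\rho')\to(\rho_1,\rho'_1)$ are pairs $(\pi,\pi')$ with $\pi:\rho\to\rho_1$ in $\mathcal{P}$, $\pi':\rho'\to\rho'_1$ in $\mathcal{P}'$, $\mathbf{R}(\pi)=\mathbf{L}'(\pi')$. Let $\mathbf{L}''(\rho,\rho')=\mathbf{L}(\rho)$, $\mathbf{L}''(\pi,\pi')=\mathbf{L}(\pi)$, $\mathbf{R}''(\rho,\rho')=\mathbf{R}'(\rho')$, $\mathbf{R}''(\pi,\pi')=\mathbf{R}'(\pi')$. Then $\mathcal{R}s'\circ\mathcal{R}s=(\mathcal{L}\xleftarrow{\mathbf{L}''}\mathcal{P}''\xrightarrow{\mathbf{R}''}\mathcal{R}',S'')$ where for $\rho''=(\rho,\rho')$ the domain of $S''_{\rho''}$ consists of the $f\in\mathrm{dom}(S_\rho)$ such that $f':=\mathbf{R}(S_\rho(f))\in\mathrm{dom}(S'_{\rho'})$, and $S''_{\rho''}(f)=(S_\rho(f),S'_{\rho'}(f'))$. -}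

module Defs where

open import Level using (Level; _⊔_) renaming (suc to lsuc)
open import Data.Product using (Σ; _,_; proj₁; proj₂)
open import Data.Maybe using (Maybe; just; nothing)
open import Relation.Binary.PropositionalEquality
  using (_≡_; refl; sym; trans; cong; subst)

record Category (o ℓ : Level) : Set (lsuc (o ⊔ ℓ)) where
  infixr 9 _∘_
  field
    Obj  : Set o
    Hom  : Obj → Obj → Set ℓ
    id   : ∀ {A} → Hom A A
    _∘_  : ∀ {A B C} → Hom B C → Hom A B → Hom A C
    identityˡ : ∀ {A B} (f : Hom A B) → id ∘ f ≡ f
    identityʳ : ∀ {A B} (f : Hom A B) → f ∘ id ≡ f
    assoc : ∀ {A B C D} (h : Hom C D) (g : Hom B C) (f : Hom A B) →
            (h ∘ g) ∘ f ≡ h ∘ (g ∘ f)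

  Arr : Set (o ⊔ ℓ)
  Arr = Σ Obj λ A → Σ Obj λ B → Hom A B

  arr : ∀ {A B} → Hom A B → Arr
  arr {A} {B} f = A , B , f

  Out : Obj → Set (o ⊔ ℓ)
  Out A = Σ Obj λ B → Hom A B

open Category public using (Obj; Hom; Arr; Out)

record Functor {o₁ ℓ₁ o₂ ℓ₂} (C : Category o₁ ℓ₁) (D : Category o₂ ℓ₂)
       : Set (o₁ ⊔ ℓ₁ ⊔ o₂ ⊔ ℓ₂) where
  private
    module C = Category C
    module D = Category D
  field
    F₀ : C.Obj → D.Obj
    F₁ : ∀ {A B} → C.Hom A B → D.Hom (F₀ A) (F₀ B)
    F-id : ∀ {A} → F₁ (C.id {A}) ≡ D.id
    F-∘  : ∀ {A B E} (g : C.Hom B E) (f : C.Hom A B) →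
           F₁ (g C.∘ f) ≡ F₁ g D.∘ F₁ f

  mapOut : ∀ {A} → C.Out A → D.Out (F₀ A)
  mapOut (B , f) = F₀ B , F₁ f

-- Categorical rewriting systems  𝓛 ←L− 𝓟 −R→ 𝓡 with partial S_ρ.
-- A partial function X ⇀ Y is a function X → Maybe Y.

record RewSys {o₁ ℓ₁ o₂ ℓ₂ o₃ ℓ₃}
       (𝓛 : Category o₁ ℓ₁) (𝓟 : Category o₂ ℓ₂) (𝓡 : Category o₃ ℓ₃)
       : Set (o₁ ⊔ ℓ₁ ⊔ o₂ ⊔ ℓ₂ ⊔ o₃ ⊔ ℓ₃) where
  field
    𝐋 : Functor 𝓟 𝓛
    𝐑 : Functor 𝓟 𝓡
    S : (ρ : Obj 𝓟) → Out 𝓛 (Functor.F₀ 𝐋 ρ) → Maybe (Out 𝓟 ρ)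
    S-sound : ∀ ρ f g → S ρ f ≡ just g → Functor.mapOut 𝐋 g ≡ f

record IsFunctorial {o₁ ℓ₁ o₂ ℓ₂ o₃ ℓ₃}
       {𝓛 : Category o₁ ℓ₁} {𝓟 : Category o₂ ℓ₂} {𝓡 : Category o₃ ℓ₃}
       (Rs : RewSys 𝓛 𝓟 𝓡) : Set (o₁ ⊔ ℓ₁ ⊔ o₂ ⊔ ℓ₂ ⊔ o₃ ⊔ ℓ₃) where
  open RewSys Rs
  private
    module 𝓛 = Category 𝓛
    module 𝓟 = Category 𝓟
    module 𝐋 = Functor 𝐋
  field
    S-id : ∀ ρ → S ρ (𝐋.F₀ ρ , 𝓛.id) ≡ just (ρ , 𝓟.id)
    S-∘ : ∀ ρ ρ₁ (f₁ : 𝓛.Hom (𝐋.F₀ ρ) (𝐋.F₀ ρ₁)) (π₁ : 𝓟.Hom ρ ρ₁) →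
          S ρ (𝐋.F₀ ρ₁ , f₁) ≡ just (ρ₁ , π₁) →
          ∀ L₂ (f₂ : 𝓛.Hom (𝐋.F₀ ρ₁) L₂) ρ₂ (π₂ : 𝓟.Hom ρ₁ ρ₂) →
          S ρ₁ (L₂ , f₂) ≡ just (ρ₂ , π₂) →
          S ρ (L₂ , f₂ 𝓛.∘ f₁) ≡ just (ρ₂ , π₂ 𝓟.∘ π₁)

private
  arr-∘ : ∀ {o ℓ} (C : Category o ℓ) {A B E A' B' E'}
          {f : Hom C A B} {g : Hom C B E} {f' : Hom C A' B'} {g' : Hom C B' E'} →
          Category.arr C f ≡ Category.arr C f' →
          Category.arr C g ≡ Category.arr C g' →
          Category.arr C (Category._∘_ C g f) ≡ Category.arr C (Category._∘_ C g' f')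
  arr-∘ C refl refl = refl

  arr-id : ∀ {o ℓ} (C : Category o ℓ) {A A'} {f : Hom C A A} {f' : Hom C A' A'} →
           A ≡ A' → f ≡ Category.id C → f' ≡ Category.id C →
           Category.arr C f ≡ Category.arr C f'
  arr-id C refl refl refl = refl

  -- uses K (uniqueness of identity proofs)
  Σ≡ : ∀ {a b c} {A : Set a} {B : Set b} {C : Set c} {F : A → C} {G : B → C}
       {x x' : A} {y y' : B} {p : F x ≡ G y} {p' : F x' ≡ G y'} →
       (q : x ≡ x') → (r : y ≡ y') →
       (_≡_ {A = Σ A λ x → Σ B λ y → F x ≡ G y} (x , y , p) (x' , y' , p'))
  Σ≡ {p = p} {p'} refl refl = cong (λ z → _ , _ , z) (uip p p')
    where
    uip : ∀ {c} {X : Set c} {u v : X} (s t : u ≡ v) → s ≡ t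
    uip refl refl = refl

-- objects of the pullback 𝓟'' of 𝐑 and 𝐋'
record PObj {o₁ ℓ₁ o₂ ℓ₂ o₃ ℓ₃}
       {𝓟 : Category o₁ ℓ₁} {𝓡 : Category o₂ ℓ₂} {𝓟' : Category o₃ ℓ₃}
       (𝐑 : Functor 𝓟 𝓡) (𝐋' : Functor 𝓟' 𝓡) : Set (o₁ ⊔ o₂ ⊔ o₃) where
  constructor pobj
  field
    ρ  : Obj 𝓟
    ρ' : Obj 𝓟'
    eq : Functor.F₀ 𝐑 ρ ≡ Functor.F₀ 𝐋' ρ'

Pullback : ∀ {o₁ ℓ₁ o₂ ℓ₂ o₃ ℓ₃}
       {𝓟 : Category o₁ ℓ₁} {𝓡 : Category o₂ ℓ₂} {𝓟' : Category o₃ ℓ₃}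
       (𝐑 : Functor 𝓟 𝓡) (𝐋' : Functor 𝓟' 𝓡) →
       Category (o₁ ⊔ o₂ ⊔ o₃) (ℓ₁ ⊔ o₂ ⊔ ℓ₂ ⊔ ℓ₃)
Pullback {𝓟 = 𝓟} {𝓡} {𝓟'} 𝐑 𝐋' = record
  { Obj = PObj 𝐑 𝐋'
  ; Hom = λ X Y → Σ (𝓟.Hom (PObj.ρ X) (PObj.ρ Y)) λ π →
                  Σ (𝓟'.Hom (PObj.ρ' X) (PObj.ρ' Y)) λ π' →
                  𝓡.arr (𝐑.F₁ π) ≡ 𝓡.arr (𝐋'.F₁ π')
  ; id = λ {X} → 𝓟.id , 𝓟'.id , arr-id 𝓡 (PObj.eq X) 𝐑.F-id 𝐋'.F-id
  ; _∘_ = λ { (π₂ , π₂' , e₂) (π₁ , π₁' , e₁) →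
              π₂ 𝓟.∘ π₁ , π₂' 𝓟'.∘ π₁' ,
              trans (cong 𝓡.arr (𝐑.F-∘ π₂ π₁))
                (trans (arr-∘ 𝓡 e₁ e₂) (cong 𝓡.arr (sym (𝐋'.F-∘ π₂' π₁')))) }
  ; identityˡ = λ { (π , π' , e) → Σ≡ (𝓟.identityˡ π) (𝓟'.identityˡ π') }
  ; identityʳ = λ { (π , π' , e) → Σ≡ (𝓟.identityʳ π) (𝓟'.identityʳ π') }
  ; assoc = λ { (π₃ , π₃' , _) (π₂ , π₂' , _) (π₁ , π₁' , _) →
                Σ≡ (𝓟.assoc π₃ π₂ π₁) (𝓟'.assoc π₃' π₂' π₁') }
  }
  where
  module 𝓟 = Category 𝓟
  module 𝓟' = Category 𝓟'
  module 𝓡 = Category 𝓡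
  module 𝐑 = Functor 𝐑
  module 𝐋' = Functor 𝐋'

private
  -- from 𝐋'(π') = 𝐑(π) (transported along R ρ ≡ L' ρ') extract the
  -- object equality and the morphism equality
  out-arr : ∀ {o ℓ} (C : Category o ℓ) {A A' : Obj C} (e : A ≡ A')
            {X Y : Obj C} {g : Hom C A' X} {h : Hom C A Y} →
            _≡_ {A = Out C A'} (X , g) (subst (Out C) e (Y , h)) →
            Category.arr C h ≡ Category.arr C g
  out-arr C refl refl = refl

  arr-tgt : ∀ {o ℓ} (C : Category o ℓ) {A A' B B' : Obj C}
            {h : Hom C A B} {g : Hom C A' B'} →
            Category.arr C h ≡ Category.arr C g → B ≡ B'
  arr-tgt C refl = refl

module _ {o₁ ℓ₁ o₂ ℓ₂ o₃ ℓ₃ o₄ ℓ₄ o₅ ℓ₅}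
         {𝓛 : Category o₁ ℓ₁} {𝓟 : Category o₂ ℓ₂} {𝓡 : Category o₃ ℓ₃}
         {𝓟' : Category o₄ ℓ₄} {𝓡' : Category o₅ ℓ₅}
         (Rs' : RewSys 𝓡 𝓟' 𝓡') (Rs : RewSys 𝓛 𝓟 𝓡) where
  private
    module Rs = RewSys Rs
    module Rs' = RewSys Rs'
    module 𝐋 = Functor Rs.𝐋
    module 𝐑 = Functor Rs.𝐑
    module 𝐋' = Functor Rs'.𝐋
    module 𝐑' = Functor Rs'.𝐑

  S''-step : (X : PObj Rs.𝐑 Rs'.𝐋) (ρ₁ : Obj 𝓟) (π : Hom 𝓟 (PObj.ρ X) ρ₁) →
             Maybe (Out (Pullback Rs.𝐑 Rs'.𝐋) X)
  S''-step (pobj ρ ρ' e) ρ₁ π with Rs'.S ρ' (subst (Out 𝓡) e (𝐑.mapOut (ρ₁ , π)))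
                                  | Rs'.S-sound ρ' (subst (Out 𝓡) e (𝐑.mapOut (ρ₁ , π)))
  ... | nothing | _ = nothing
  ... | just (ρ₁' , π') | snd =
    let ea = out-arr 𝓡 e (snd (ρ₁' , π') refl) in
    just (pobj ρ₁ ρ₁' (arr-tgt 𝓡 ea) , π , π' , ea)

  S'' : (X : PObj Rs.𝐑 Rs'.𝐋) → Out 𝓛 (𝐋.F₀ (PObj.ρ X)) →
        Maybe (Out (Pullback Rs.𝐑 Rs'.𝐋) X)
  S'' X f with Rs.S (PObj.ρ X) f
  ... | nothing = nothing
  ... | just (ρ₁ , π) = S''-step X ρ₁ π

  private
    step-sound : ∀ X ρ₁ π g → S''-step X ρ₁ π ≡ just g →
                 (PObj.ρ (proj₁ g) , proj₁ (proj₂ g)) ≡ (ρ₁ , π)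
    step-sound (pobj ρ ρ' e) ρ₁ π g eq
      with Rs'.S ρ' (subst (Out 𝓡) e (𝐑.mapOut (ρ₁ , π)))
         | Rs'.S-sound ρ' (subst (Out 𝓡) e (𝐑.mapOut (ρ₁ , π)))
    step-sound (pobj ρ ρ' e) ρ₁ π g () | nothing | _
    step-sound (pobj ρ ρ' e) ρ₁ π g refl | just (ρ₁' , π') | snd = refl

    S''-sound : ∀ X f g → S'' X f ≡ just g →
                Functor.mapOut Rs.𝐋 (PObj.ρ (proj₁ g) , proj₁ (proj₂ g)) ≡ f
    S''-sound X f g eq with Rs.S (PObj.ρ X) f | Rs.S-sound (PObj.ρ X) f
    S''-sound X f g () | nothing | _
    ... | just (ρ₁ , π) | snd =
      trans (cong 𝐋.mapOut (step-sound X ρ₁ π g eq)) (snd (ρ₁ , π) refl)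

  _∘RS_ : RewSys 𝓛 (Pullback Rs.𝐑 Rs'.𝐋) 𝓡'
  _∘RS_ = record
    { 𝐋 = record
      { F₀ = λ X → 𝐋.F₀ (PObj.ρ X)
      ; F₁ = λ p → 𝐋.F₁ (proj₁ p)
      ; F-id = 𝐋.F-id
      ; F-∘ = λ g f → 𝐋.F-∘ (proj₁ g) (proj₁ f)
      }
    ; 𝐑 = record
      { F₀ = λ X → 𝐑'.F₀ (PObj.ρ' X)
      ; F₁ = λ p → 𝐑'.F₁ (proj₁ (proj₂ p))
      ; F-id = 𝐑'.F-id
      ; F-∘ = λ g f → 𝐑'.F-∘ (proj₁ (proj₂ g)) (proj₁ (proj₂ f))
      }
    ; S = S''
    ; S-sound = S''-sound
    }

{-# OPTIONS --safe #-}
module Submission where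

open import Defs
open import Level using (Level)
open import Data.Product using (_,_; proj₁; proj₂; _×_)
open import Data.Maybe using (just)
open import Relation.Binary.PropositionalEquality
  using (_≡_; refl; sym; trans; cong; cong₂; subst)
open import Axiom.UniquenessOfIdentityProofs.WithK using (uip)

-- S''(f) is assembled from S(f) and S'(𝐑(S(f))), and a morphism of the pullback
-- is a pair (π , π') whose square 𝐑(π) = 𝐋'(π') commutes. Replacing 𝐑(π) by
-- 𝐋'(π') across that square, the identity and composition laws of S'' reduce
-- componentwise to those of S and S'; the remaining coherence proofs are unique by K.

subst-Out-arr : ∀ {o ℓ} (C : Category o ℓ) {A A' B B' : Obj C} (e : A ≡ A')
                {h : Hom C A B} {g : Hom C A' B'} →
                Category.arr C h ≡ Category.arr C g →
                subst (Out C) e (B , h) ≡ (B' , g)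
subst-Out-arr C refl refl = refl

module Composite {o₁ ℓ₁ o₂ ℓ₂ o₃ ℓ₃ o₄ ℓ₄ o₅ ℓ₅ : Level}
    {𝓛 : Category o₁ ℓ₁} {𝓟 : Category o₂ ℓ₂} {𝓡 : Category o₃ ℓ₃}
    {𝓟' : Category o₄ ℓ₄} {𝓡' : Category o₅ ℓ₅}
    (Rs : RewSys 𝓛 𝓟 𝓡) (Rs' : RewSys 𝓡 𝓟' 𝓡') where
  private
    module Rs = RewSys Rs
    module Rs' = RewSys Rs'
    module 𝐋 = Functor Rs.𝐋
    module 𝐑 = Functor Rs.𝐑
    module 𝐋' = Functor Rs'.𝐋
    module 𝓛 = Category 𝓛
    module 𝓟'' = Category (Pullback Rs.𝐑 Rs'.𝐋)
  open PObj

  transported-𝐑-image≡𝐋'-image : ∀ {X Y} (p : 𝓟''.Hom X Y) →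
    subst (Out 𝓡) (eq X) (𝐑.mapOut (ρ Y , proj₁ p)) ≡ 𝐋'.mapOut (ρ' Y , proj₁ (proj₂ p))
  transported-𝐑-image≡𝐋'-image {X} (π , π' , square) =
    subst-Out-arr 𝓡 (eq X) square

  -- S-sound is abstracted alongside S because S''-step abstracts both.
  S''-step-just : ∀ {X Y} (p : 𝓟''.Hom X Y) →
    Rs'.S (ρ' X) (subst (Out 𝓡) (eq X) (𝐑.mapOut (ρ Y , proj₁ p)))
      ≡ just (ρ' Y , proj₁ (proj₂ p)) →
    S''-step Rs' Rs X (ρ Y) (proj₁ p) ≡ just (Y , p)
  S''-step-just {pobj _ ρ₀' e₀} {pobj ρ₁ ρ₁' e₁} (π , π' , square) hS'
    with Rs'.S ρ₀' (subst (Out 𝓡) e₀ (𝐑.mapOut (ρ₁ , π)))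
       | Rs'.S-sound ρ₀' (subst (Out 𝓡) e₀ (𝐑.mapOut (ρ₁ , π)))
  S''-step-just {pobj _ _ _} {pobj ρ₁ ρ₁' e₁} (π , π' , square) refl | just ._ | _ =
    cong₂ (λ e ea → just (pobj ρ₁ ρ₁' e , π , π' , ea)) (uip _ _) (uip _ _)

  S''-just : ∀ {X Y} f (p : 𝓟''.Hom X Y) →
    Rs.S (ρ X) f ≡ just (ρ Y , proj₁ p) →
    Rs'.S (ρ' X) (𝐋'.mapOut (ρ' Y , proj₁ (proj₂ p))) ≡ just (ρ' Y , proj₁ (proj₂ p)) →
    S'' Rs' Rs X f ≡ just (Y , p)
  S''-just {X} {Y} f p _ _ with Rs.S (ρ X) f
  S''-just {X} {Y} f p refl hS' | just ._ =
    S''-step-just p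
      (trans (cong (Rs'.S (ρ' X)) (transported-𝐑-image≡𝐋'-image {X} {Y} p)) hS')

  S''-just-inv : ∀ {X Y} f (p : 𝓟''.Hom X Y) →
    S'' Rs' Rs X f ≡ just (Y , p) →
    Rs.S (ρ X) f ≡ just (ρ Y , proj₁ p) ×
    Rs'.S (ρ' X) (𝐋'.mapOut (ρ' Y , proj₁ (proj₂ p))) ≡ just (ρ' Y , proj₁ (proj₂ p))
  S''-just-inv {pobj ρ₀ ρ₀' e₀} f p _ with Rs.S ρ₀ f
  ... | just (ρ₁ , π)
    with Rs'.S ρ₀' (subst (Out 𝓡) e₀ (𝐑.mapOut (ρ₁ , π))) in hS'
       | Rs'.S-sound ρ₀' (subst (Out 𝓡) e₀ (𝐑.mapOut (ρ₁ , π)))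
  S''-just-inv {X@(pobj _ ρ₀' _)} {Y} f p refl | just (ρ₁ , π) | just _ | _ =
    refl , trans (cong (Rs'.S ρ₀') (sym (transported-𝐑-image≡𝐋'-image {X} {Y} p))) hS'

  module _ (F : IsFunctorial Rs) (F' : IsFunctorial Rs') where
    private
      module F = IsFunctorial F
      module F' = IsFunctorial F'

    S''-id : ∀ X → S'' Rs' Rs X (𝐋.F₀ (ρ X) , 𝓛.id) ≡ just (X , 𝓟''.id {X})
    S''-id X = S''-just _ (𝓟''.id {X}) (F.S-id (ρ X))
      (trans (cong (λ g → Rs'.S (ρ' X) (_ , g)) 𝐋'.F-id) (F'.S-id (ρ' X)))

    S''-∘ : ∀ X X₁ (f₁ : Hom 𝓛 (𝐋.F₀ (ρ X)) (𝐋.F₀ (ρ X₁))) (p₁ : 𝓟''.Hom X X₁) →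
      S'' Rs' Rs X (𝐋.F₀ (ρ X₁) , f₁) ≡ just (X₁ , p₁) →
      ∀ L₂ (f₂ : Hom 𝓛 (𝐋.F₀ (ρ X₁)) L₂) X₂ (p₂ : 𝓟''.Hom X₁ X₂) →
      S'' Rs' Rs X₁ (L₂ , f₂) ≡ just (X₂ , p₂) →
      S'' Rs' Rs X (L₂ , f₂ 𝓛.∘ f₁) ≡ just (X₂ , 𝓟''._∘_ {X} {X₁} {X₂} p₂ p₁)
    S''-∘ X X₁ f₁ p₁@(π₁ , π₁' , _) h₁ L₂ f₂ X₂ p₂@(π₂ , π₂' , _) h₂ =
      let hS₁ , hS'₁ = S''-just-inv _ p₁ h₁
          hS₂ , hS'₂ = S''-just-inv _ p₂ h₂
      in S''-just _ (𝓟''._∘_ {X} {X₁} {X₂} p₂ p₁)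
           (F.S-∘ (ρ X) (ρ X₁) f₁ π₁ hS₁ L₂ f₂ (ρ X₂) π₂ hS₂)
           (trans (cong (λ g → Rs'.S (ρ' X) (_ , g)) (𝐋'.F-∘ π₂' π₁'))
             (F'.S-∘ (ρ' X) (ρ' X₁) (𝐋'.F₁ π₁') π₁' hS'₁ _ (𝐋'.F₁ π₂') (ρ' X₂) π₂' hS'₂))

    isFunctorial : IsFunctorial (Rs' ∘RS Rs)
    isFunctorial = record { S-id = S''-id ; S-∘ = S''-∘ }

proposition2p12 : ∀ {o₁ ℓ₁ o₂ ℓ₂ o₃ ℓ₃ o₄ ℓ₄ o₅ ℓ₅ : Level}
    {𝓛 : Category o₁ ℓ₁} {𝓟 : Category o₂ ℓ₂} {𝓡 : Category o₃ ℓ₃}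
    {𝓟' : Category o₄ ℓ₄} {𝓡' : Category o₅ ℓ₅}
    (Rs : RewSys 𝓛 𝓟 𝓡) (Rs' : RewSys 𝓡 𝓟' 𝓡') →
    IsFunctorial Rs → IsFunctorial Rs' → IsFunctorial (Rs' ∘RS Rs)
proposition2p12 Rs Rs' = Composite.isFunctorial Rs Rs'
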